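{- Let $\mathcal{Q}=(N,\mathcal{M})$ be an abstract questionnaire with skip-list $\mathcal{S}=(S_0,\ldots,S_N)$ and flag-set $F$, where $F$ is compatible with $\mathcal{S}$, and let $T$ be the FS-decision tree of $\mathcal{Q}$ with answer string assignment $\alpha$ and flag function $\phi$. Let $f=f_0\ldots f_\ell*\ldots*\in F$, where $\ell$ satisfies conditions (i)–(iv) of compatibility for $f$. Then: (a) for every $i\in\{0,\ldots,\ell\}$ there exists a vertex $v$ of $T$ with $\alpha(v)=f_0\ldots f_i$; (b) if $v$ is the vertex of $T$ with $\alpha(v)=f_0\ldots f_\ell$, then $v$ is flagged, every descendant of $v$ is flagged, and no ancestor of $v$ is flagged.
   Context: An abstract questionnaire is a pair $(N,\mathcal{M})$ with $N$ a positive integer and $\mathcal{M}=(m_0,\ldots,m_{N-1})$ a tuple of positive integers. Put $A_i=\{0,1,\ldots,m_i-1\}$ and $A_i^*=A_i\cup\{*\}$, where $*$ is a new symbol. For $0\le k\le \ell\le N-1$, a $(k,\ell)$-answer string is a string $a_k\ldots a_\ell$ with $a_i\in A_i^*$; $\epsilon$ is the empty string; juxtaposition is concatenation. For a $(0,i)$-answer string $a_0\ldots a_i$, "$a_0\ldots a_i*\ldots*$" denotes the $(0,N-1)$-answer string obtained by appending $N-1-i$ copies of $*$. A flag-set is a set $F$ of $(0,N-1)$-answer strings; a $(0,k)$-answer string $a_0\ldots a_k$ is flagged (w.r.t. $F$) if $a_0\ldots a_i*\ldots*\in F$ for some $0\le i\le k$. A skip-list is an $(N+1)$-tuple $(S_0,\ldots,S_N)$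 such that: $S_0=S_N=\emptyset$; for $1\le q\le N$, $S_q$ is a set of $(0,q-1)$-answer strings; and for each $q$ with $1 \le q\le N-1$ and each $(0,q-1)$-answer string $a$: if $a\in S_q$, then for every $j\in A_q$, $aj\notin S_{q+1}$ and $ajb\notin S_{k+1}$ for all $q+1\le k\le N-1$ and $b\in A_{q+1}^*\times\cdots\times A_k^*$; if $a\notin S_q$, then $a*\notin S_{q+1}$ and $a*b\notin S_{k+1}$ for all such $k,b$. $F$ is compatible with $\mathcal{S}$ if for every $f\in F$ there is $\ell\in\{0,\ldots,N-1\}$ with: (i) $f=f_0\ldots f_\ell*\ldots*$; (ii) for all $i\in\{0,\ldots,\ell\}$, $f_0\ldots f_{i-1}\in S_i\iff f_i=*$ (for $i=0$ the prefix is $\epsilon$); (iii) if $f_\ell\ne*$, then for some $j\in A_\ell$, $f_0\ldots f_{\ell-1}j*\ldots*\notin F$; (iv) for all $i\in\{0,\ldots,\ell-1\}$, $f_0\ldots f_i*\ldots*\notin F$. The FS-decision tree $T$ is the ordered rooted tree, with set $U$ of skipped vertices, question assignment $\kappa$, answer string assignment $\alpha$, and flag function $\phi$, defined recursively: the root $r$ has $\kappa(r)=0$, $\alpha(r)=\epsilon$; a vertex $u$ with $\kappa(u)=q\le N$ lies in $U$ iff $\alpha(u)\in S_q$; if $\kappa(u)=q<N$ and $u\in U$, $u$ has exactly one child $c$, with $\kappa(c)=q+1$, $\alpha(c)=\alpha(u)*$; if $\kappa(u)=q<N$ and $u\notin U$, $u$ has exactly $m_q$ children, the $j$-th ($j\in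 A_q$) child $c$ having $\kappa(c)=q+1$, $\alpha(c)=\alpha(u)j$; vertices with $\kappa=N$ have no children. A vertex $v$ is flagged ($\phi(v)=1$) iff $\alpha(v)$ is flagged w.r.t. $F$. Ancestors and descendants are with respect to the root. -}

module Defs where

open import Data.Nat using (ℕ; zero; suc; _≤_; _<_; _∸_)
open import Data.Fin using (Fin; fromℕ<)
open import Data.Maybe using (Maybe; just; nothing)
open import Data.List using (List; []; _∷_; _∷ʳ_; _++_; length; take; replicate)
open import Data.Product using (Σ; _×_; _,_)
open import Relation.Binary.PropositionalEquality using (_≡_)
open import Relation.Nullary using (¬_)
open import Function.Bundles using (_⇔_)

-- A symbol of an answer string: `just j` is the answer j, `nothing` is the star *.
Sym : Set
Sym = Maybe ℕ

AnsStr : Set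
AnsStr = List Sym

-- i-th symbol of a string (default * out of range; only used in range).
_!_ : AnsStr → ℕ → Sym
[] ! _ = nothing
(x ∷ _) ! zero = x
(_ ∷ xs) ! suc i = xs ! i

stars : ℕ → AnsStr
stars k = replicate k nothing

-- Everything below is relative to an abstract questionnaire (N , m),
-- with m i the number of answers of question i (A_i = {0,…,m i - 1}).
module Questionnaire (N : ℕ) (m : Fin N → ℕ) where

  -- a is a (0, length a - 1)-answer string: length ≤ N, and each non-star
  -- entry a_i = j satisfies j ∈ A_i.
  IsAns : AnsStr → Set
  IsAns a = (length a ≤ N) ×
            (∀ i j → i < length a → a ! i ≡ just j →
               Σ (i < N) λ p → j < m (fromℕ< p))

  pad : AnsStr → AnsStr
  pad a = a ++ stars (N ∸ length a)

  record IsSkipList (S : ℕ → AnsStr → Set) : Set₁ where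
    field
      S₀-empty : ∀ a → ¬ S 0 a
      S_N-empty : ∀ a → ¬ S N a
      S-strings : ∀ q a → S q a → IsAns a × length a ≡ q
      skip-in : ∀ a → IsAns a → 1 ≤ length a → (p : length a < N) →
                S (length a) a →
                ∀ j → j < m (fromℕ< p) → ∀ b →
                IsAns (a ++ just j ∷ b) →
                ¬ S (length (a ++ just j ∷ b)) (a ++ just j ∷ b)
      skip-out : ∀ a → IsAns a → 1 ≤ length a → (p : length a < N) →
                 ¬ S (length a) a →
                 ∀ b →
                 IsAns (a ++ nothing ∷ b) →
                 ¬ S (length (a ++ nothing ∷ b)) (a ++ nothing ∷ b)

  IsFlagSet : (AnsStr → Set) → Set
  IsFlagSet F = ∀ f → F f → IsAns f × length f ≡ N

  Flagged : (AnsStr → Set) → AnsStr → Set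
  Flagged F a = Σ ℕ λ i → (suc i ≤ length a) × F (pad (take (suc i) a))

  record CompatConds (S : ℕ → AnsStr → Set) (F : AnsStr → Set)
                     (f : AnsStr) (ℓ : ℕ) : Set where
    field
      ℓ<N : ℓ < N
      cond-i : f ≡ pad (take (suc ℓ) f)
      cond-ii : ∀ i → i ≤ ℓ → (S i (take i f) ⇔ (f ! i ≡ nothing))
      cond-iii : ¬ (f ! ℓ ≡ nothing) →
                 Σ ℕ λ j → (j < m (fromℕ< ℓ<N)) × ¬ F (pad (take ℓ f ∷ʳ just j))
      cond-iv : ∀ i → i < ℓ → ¬ F (pad (take (suc i) f))

  Compatible : (ℕ → AnsStr → Set) → (AnsStr → Set) → Set
  Compatible S F = ∀ f → F f → Σ ℕ λ ℓ → CompatConds S F f ℓ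

  -- The FS-decision tree T.  A vertex u with κ(u) = q and α(u) = a is an
  -- element of `Vtx S q a`; it is built from the root by the two child rules.
  data Vtx (S : ℕ → AnsStr → Set) : ℕ → AnsStr → Set where
    root : Vtx S 0 []
    skipC : ∀ {q a} → Vtx S q a → q < N → S q a → Vtx S (suc q) (a ∷ʳ nothing)
    ansC : ∀ {q a} → Vtx S q a → (p : q < N) → ¬ S q a →
           (j : ℕ) → j < m (fromℕ< p) → Vtx S (suc q) (a ∷ʳ just j)

  data Child {S : ℕ → AnsStr → Set} :
       ∀ {q a q' a'} → Vtx S q a → Vtx S q' a' → Set where
    c-skip : ∀ {q a} (u : Vtx S q a) p s → Child u (skipC u p s)
    c-ans : ∀ {q a} (u : Vtx S q a) p s j jp → Child u (ansC u p s j jp)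

  -- u ≺ w : w is a (proper) descendant of u, i.e. u is a proper ancestor of w
  data _≺_ {S : ℕ → AnsStr → Set} :
       ∀ {q a q' a'} → Vtx S q a → Vtx S q' a' → Set where
    one : ∀ {q a q' a'} {u : Vtx S q a} {w : Vtx S q' a'} → Child u w → u ≺ w
    more : ∀ {q a q' a' q'' a''} {u : Vtx S q a} {w : Vtx S q' a'}
             {x : Vtx S q'' a''} → u ≺ w → Child w x → u ≺ x

{-# OPTIONS --safe #-}
module Submission where

open import Defs
open import Data.Nat using (ℕ; _≤_; _<_; suc; zero; s≤s; s≤s⁻¹)
open import Data.Nat.Properties
  using (≤-refl; ≤-reflexive; ≤-trans; <-≤-trans; <⇒≤; m<n⇒m<1+n; n<1+n; m≤n⇒m⊓n≡m; m⊓n≤m; m⊓n≤n)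
open import Data.Fin using (Fin)
open import Data.Maybe using (just; nothing)
open import Data.List using (List; []; _∷_; _∷ʳ_; length; take)
open import Data.List.Properties using (length-take; take-take; take-all)
open import Data.Product using (Σ; _×_; _,_; proj₁; proj₂)
open import Relation.Nullary using (¬_)
open import Relation.Binary.PropositionalEquality
open import Function.Bundles using (_⇔_; Equivalence)

-- Condition (ii) says that the entries of f are exactly the edges the tree
-- offers along f (a star precisely where the prefix is skipped), so every
-- prefix f₀…f_i labels a vertex.  Along tree edges answer strings only grow,
-- so the descendants of v carry extensions of f₀…f_ℓ, flagged through f
-- itself by (i), while the ancestors carry proper prefixes f₀…f_k, k < ℓ,
-- whose flagging would require some f₀…f_i*…* ∈ F with i < ℓ, excluded by
-- (iv).

take-suc-! : ∀ i (xs : AnsStr) → i < length xs → take (suc i) xs ≡ take i xs ∷ʳ (xs ! i)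
take-suc-! zero    (x ∷ xs) _       = refl
take-suc-! (suc i) (x ∷ xs) (s≤s p) = cong (x ∷_) (take-suc-! i xs p)

module _ {a} {A : Set a} where

  length-∷ʳ : ∀ (xs : List A) x → length (xs ∷ʳ x) ≡ suc (length xs)
  length-∷ʳ []       _ = refl
  length-∷ʳ (_ ∷ xs) x = cong suc (length-∷ʳ xs x)

  take-∷ʳ : ∀ n (xs : List A) {x} → n ≤ length xs → take n (xs ∷ʳ x) ≡ take n xs
  take-∷ʳ zero    xs       _       = refl
  take-∷ʳ (suc n) (y ∷ xs) (s≤s p) = cong (y ∷_) (take-∷ʳ n xs p)

  take-length-∷ʳ : ∀ (xs : List A) {x} → take (length xs) (xs ∷ʳ x) ≡ xs
  take-length-∷ʳ xs = trans (take-∷ʳ (length xs) xs ≤-refl) (take-all (length xs) xs ≤-refl)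

  take-take-≤ : ∀ {m n} (xs : List A) → m ≤ n → take m (take n xs) ≡ take m xs
  take-take-≤ {m} {n} xs m≤n = trans (take-take m n xs) (cong (λ k → take k xs) (m≤n⇒m⊓n≡m m≤n))

  length-take-≤ˡ : ∀ n (xs : List A) → length (take n xs) ≤ n
  length-take-≤ˡ n xs = subst (_≤ n) (sym (length-take n xs)) (m⊓n≤m n (length xs))

  length-take-≤ʳ : ∀ n (xs : List A) → length (take n xs) ≤ length xs
  length-take-≤ʳ n xs = subst (_≤ length xs) (sym (length-take n xs)) (m⊓n≤n n (length xs))

  length-take-of-≤ : ∀ n (xs : List A) → n ≤ length xs → length (take n xs) ≡ n
  length-take-of-≤ n xs n≤xs = trans (length-take n xs) (m≤n⇒m⊓n≡m n≤xs)

module FSDecisionTree (N : ℕ) (m : Fin N → ℕ) where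
  open Questionnaire N m

  module _ {S : ℕ → AnsStr → Set} where

    child-extends : ∀ {q a q' a'} {u : Vtx S q a} {w : Vtx S q' a'} →
                    Child u w → Σ Sym λ s → a' ≡ a ∷ʳ s
    child-extends (c-skip _ _ _)    = nothing , refl
    child-extends (c-ans _ _ _ j _)    = just j , refl

    ≺⇒proper-prefix : ∀ {q a q' a'} {u : Vtx S q a} {w : Vtx S q' a'} →
                      u ≺ w → a ≡ take (length a) a' × length a < length a'
    ≺⇒proper-prefix {a = a} (one c) with child-extends c
    ... | s , refl = sym (take-length-∷ʳ a) , ≤-reflexive (sym (length-∷ʳ a s))
    ≺⇒proper-prefix {a = a} (more {a' = b} u≺w c) with child-extends c | ≺⇒proper-prefix u≺w
    ... | s , refl | a≡ , a<b =
      trans a≡ (sym (take-∷ʳ (length a) b (<⇒≤ a<b))) ,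
      subst (length a <_) (sym (length-∷ʳ b s)) (m<n⇒m<1+n a<b)

    consistent-prefix-vertex :
      ∀ c → IsAns c → ∀ k → k ≤ length c →
      (∀ i → i < k → S i (take i c) ⇔ (c ! i ≡ nothing)) → Vtx S k (take k c)
    consistent-prefix-vertex c _ zero _ _ = root
    consistent-prefix-vertex c ans@(c≤N , entries) (suc k) k<c consistent
      rewrite take-suc-! k c k<c = child (c ! k) refl
      where
        parent : Vtx S k (take k c)
        parent = consistent-prefix-vertex c ans k (<⇒≤ k<c)
                   (λ i i<k → consistent i (m<n⇒m<1+n i<k))

        skipped⇔star : S k (take k c) ⇔ (c ! k ≡ nothing)
        skipped⇔star = consistent k (n<1+n k)

        child : ∀ s → c ! k ≡ s → Vtx S (suc k) (take k c ∷ʳ s)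
        child nothing  ck≡* = skipC parent (<-≤-trans k<c c≤N) (Equivalence.from skipped⇔star ck≡*)
        child (just j) ck≡j with entries k j k<c ck≡j
        ... | k<N , j<m =
          ansC parent k<N not-skipped j j<m
          where
            not-skipped : ¬ S k (take k c)
            not-skipped skipped with () ← trans (sym ck≡j) (Equivalence.to skipped⇔star skipped)

  module _ (F : AnsStr → Set) where

    flagged-take-witness : ∀ k a → Flagged F (take k a) →
                           Σ ℕ λ i → (suc i ≤ k) × (suc i ≤ length a) × F (pad (take (suc i) a))
    flagged-take-witness k a (i , i<ak , flag) =
      i , i<k , ≤-trans i<ak (length-take-≤ʳ k a) , subst F (cong pad (take-take-≤ a i<k)) flag
      where
        i<k : suc i ≤ k
        i<k = ≤-trans i<ak (length-take-≤ˡ k a)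

    flagged-take⇒flagged : ∀ k a → Flagged F (take k a) → Flagged F a
    flagged-take⇒flagged k a flag with flagged-take-witness k a flag
    ... | i , _ , i<a , flagᵢ = i , i<a , flagᵢ

  module FlagString {S : ℕ → AnsStr → Set} {F : AnsStr → Set} (isFlagSet : IsFlagSet F)
                    {f : AnsStr} (Ff : F f) {ℓ : ℕ} (compat : CompatConds S F f ℓ) where
    open CompatConds compat

    ℓ<∣f∣ : ℓ < length f
    ℓ<∣f∣ = <-≤-trans ℓ<N (≤-reflexive (sym (proj₂ (isFlagSet f Ff))))

    prefix-vertex : ∀ i → i ≤ ℓ → Vtx S (suc i) (take (suc i) f)
    prefix-vertex i i≤ℓ =
      consistent-prefix-vertex f (proj₁ (isFlagSet f Ff)) (suc i) (≤-trans (s≤s i≤ℓ) ℓ<∣f∣)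
        (λ j j<1+i → cond-ii j (≤-trans (s≤s⁻¹ j<1+i) i≤ℓ))

    flagged-at-ℓ : Flagged F (take (suc ℓ) f)
    flagged-at-ℓ =
      ℓ , ≤-reflexive (sym (length-take-of-≤ (suc ℓ) f ℓ<∣f∣)) ,
      subst F (trans cond-i (cong pad (sym (take-take-≤ {m = suc ℓ} f ≤-refl)))) Ff

    unflagged-before-ℓ : ∀ k → k ≤ ℓ → ¬ Flagged F (take k f)
    unflagged-before-ℓ k k≤ℓ flag with flagged-take-witness F k f flag
    ... | i , i<k , _ , flagᵢ = cond-iv i (<-≤-trans i<k k≤ℓ) flagᵢ

    descendant-flagged : ∀ {q q' a'} {v : Vtx S q (take (suc ℓ) f)} {w : Vtx S q' a'} →
                         v ≺ w → Flagged F a'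
    descendant-flagged {a' = a'} v≺w =
      flagged-take⇒flagged F (length (take (suc ℓ) f)) a'
        (subst (Flagged F) (proj₁ (≺⇒proper-prefix v≺w)) flagged-at-ℓ)

    ancestor-unflagged : ∀ {q q' a'} {u : Vtx S q' a'} {v : Vtx S q (take (suc ℓ) f)} →
                         u ≺ v → ¬ Flagged F a'
    ancestor-unflagged {a' = a'} u≺v with ≺⇒proper-prefix u≺v
    ... | a'≡ , a'<fℓ =
      subst (λ a → ¬ Flagged F a) (sym a'≡fₖ) (unflagged-before-ℓ (length a') (s≤s⁻¹ a'<1+ℓ))
      where
        a'<1+ℓ : length a' < suc ℓ
        a'<1+ℓ = <-≤-trans a'<fℓ (length-take-≤ˡ (suc ℓ) f)
        a'≡fₖ : a' ≡ take (length a') f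
        a'≡fₖ = trans a'≡ (take-take-≤ f (<⇒≤ a'<1+ℓ))

lemma4p9 : (N : ℕ) (m : Fin N → ℕ) → (∀ i → 0 < m i) →
           (S : ℕ → AnsStr → Set) → Questionnaire.IsSkipList N m S →
           (F : AnsStr → Set) → Questionnaire.IsFlagSet N m F →
           Questionnaire.Compatible N m S F →
           (f : AnsStr) → F f → (ℓ : ℕ) → Questionnaire.CompatConds N m S F f ℓ →
           ((i : ℕ) → i ≤ ℓ →
              Σ ℕ λ q → Questionnaire.Vtx N m S q (take (suc i) f))
           ×
           (∀ q (v : Questionnaire.Vtx N m S q (take (suc ℓ) f)) →
              Questionnaire.Flagged N m F (take (suc ℓ) f)
              × (∀ q' a' (w : Questionnaire.Vtx N m S q' a') →
                   Questionnaire._≺_ N m v w → Questionnaire.Flagged N m F a')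
              × (∀ q' a' (u : Questionnaire.Vtx N m S q' a') →
                   Questionnaire._≺_ N m u v → ¬ Questionnaire.Flagged N m F a'))
lemma4p9 N m _ S _ F isFlagSet _ f Ff ℓ compat =
  (λ i i≤ℓ → suc i , prefix-vertex i i≤ℓ) ,
  (λ _ _ → flagged-at-ℓ , (λ _ _ _ → descendant-flagged) , (λ _ _ _ → ancestor-unflagged))
  where open FSDecisionTree N m
        open FlagString isFlagSet Ff compat
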